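{- (1) Let $v$ be a weighted game and $u$ a linear game on $n$ voters with $W_u=W_v\setminus\{A\}$ for a coalition $A\in W_v$. Then $u$ is weighted if and only if there exists $\mathbf w$ in the footprint $\pi(P_v)$ such that $w_A<w_B$ for every winning coalition $B\neq A$ of $v$. (2) Let $u$ be a weighted game and $v$ a linear game on $n$ voters with $W_u=W_v\setminus\{A\}$ for a coalition $A\in W_v$. Then $v$ is weighted if and only if there exists $\mathbf w$ in the footprint $\pi(P_u)$ such that $w_A>w_C$ for every losing coalition $C\neq A$ of $u$.
   Context: Let $N=\{1,\dots,n\}$. A simple game is a family $W$ of subsets of $N$ (winning coalitions) with $N\in W$, $\emptyset\notin W$, closed under supersets. Order subsets of $N$ by: for $A=\{a_1>\dots>a_k\}$, $B=\{b_1>\dots>b_j\}$, $B\ge A$ iff $k\le j$ and $b_i\ge a_i$ for $i\le k$. A linear game is a simple game whose winning set is an up-set for this order. Let $\Delta_n=\{\mathbf w=(w_n,\dots,w_1): w_n\ge\dots\ge w_1\ge0,\ \sum_i w_i=1\}$ and for a coalition $A$ write $w_A=\sum_{i\in A}w_i$. A linear game $v$ is weighted if there is $(q:\mathbf w)\in(0,1]\times\Delta_n$ with $A\in W_v$ iff $w_A\ge q$ (a realization); $P_v$ is the set of realizations, and the footprint $\pi(P_v)\subseteq\Delta_n$ is the set of $\mathbf w$ for which some $(q:\mathbf w)$ lies in $P_v$.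
   Formalization: The weights and quotas of realizations are rational, so the points of $\Delta_n$ and of the footprints $\pi(P_v)$, $\pi(P_u)$ have rational coordinates. -}

module Defs where

open import Data.Nat as ℕ using (ℕ; zero; suc)
open import Data.Fin using (Fin; zero; suc; toℕ)
open import Data.Fin.Subset using (Subset; _⊆_; ⊤; ⊥)
open import Data.Vec using (Vec; []; _∷_)
open import Data.Bool using (Bool; true; false; if_then_else_)
open import Data.List using (List; []; _∷_; _++_; map; reverse)
open import Data.Rational using (ℚ; 0ℚ; 1ℚ; _+_; _≤_; _<_)
open import Data.Product using (_×_; Σ; ∃)
open import Data.Unit using () renaming (⊤ to Unit)
open import Data.Empty using () renaming (⊥ to Empty)
open import Relation.Binary.PropositionalEquality using (_≡_)

-- Voters are Fin n; voter i : Fin n is the paper's voter (toℕ i + 1).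

Game : ℕ → Set
Game n = Subset n → Bool

Wins : ∀ {n} → Game n → Subset n → Set
Wins W A = W A ≡ true

membersInc : ∀ {n} → Subset n → List ℕ
membersInc []          = []
membersInc (b ∷ p)     = (if b then 0 ∷ [] else []) ++ map suc (membersInc p)

membersDec : ∀ {n} → Subset n → List ℕ
membersDec p = reverse (membersInc p)

-- Dom bs as : (a₁ > … > a_k) vs (b₁ > … > b_j): k ≤ j and bᵢ ≥ aᵢ for i ≤ k
Dom : List ℕ → List ℕ → Set
Dom bs       []       = Unit
Dom []       (a ∷ as) = Empty
Dom (b ∷ bs) (a ∷ as) = (a ℕ.≤ b) × Dom bs as

_≽_ : ∀ {n} → Subset n → Subset n → Set
B ≽ A = Dom (membersDec B) (membersDec A)

record IsSimple {n} (W : Game n) : Set where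
  field
    full-wins   : Wins W ⊤
    empty-loses : W ⊥ ≡ false
    monotone    : ∀ A B → A ⊆ B → Wins W A → Wins W B

record IsLinear {n} (W : Game n) : Set where
  field
    simple : IsSimple W
    upset  : ∀ A B → B ≽ A → Wins W A → Wins W B

weightOf : ∀ {n} → (Fin n → ℚ) → Subset n → ℚ
weightOf w []           = 0ℚ
weightOf w (true  ∷ p)  = w zero + weightOf (λ i → w (suc i)) p
weightOf w (false ∷ p)  = weightOf (λ i → w (suc i)) p

record InSimplex {n} (w : Fin n → ℚ) : Set where
  field
    nonneg : ∀ i → 0ℚ ≤ w i
    mono   : ∀ i j → toℕ i ℕ.≤ toℕ j → w i ≤ w j
    sum1   : weightOf w ⊤ ≡ 1ℚ

record Realizes {n} (W : Game n) (q : ℚ) (w : Fin n → ℚ) : Set where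
  field
    q-pos     : 0ℚ < q
    q-le1     : q ≤ 1ℚ
    simplex   : InSimplex w
    wins→     : ∀ A → Wins W A → q ≤ weightOf w A
    →wins     : ∀ A → q ≤ weightOf w A → Wins W A

InFootprint : ∀ {n} → Game n → (Fin n → ℚ) → Set
InFootprint W w = ∃ λ q → Realizes W q w

IsWeighted : ∀ {n} → Game n → Set
IsWeighted W = IsLinear W × ∃ λ w → InFootprint W w

-- Everything goes through weight vectors w ∈ Δ_n with w_C < w_A < w_B whenever
-- C loses in v and B wins in u. Such a w realizes v at threshold w_A and, A being
-- the heaviest coalition losing in u, realizes u at any threshold in
-- (w_A, min_{B ∈ W_u} w_B]. Conversely, given realizations (q : w) of v and
-- (q′ : w′) of u, A has a positive defect in each: w_A − max_{C ∉ W_v} w_C and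
-- q′ − w′_A. The convex combination of w and w′ that weights each by the other's
-- defect puts A exactly where both realizations meet their thresholds.

module Submission where

open import Defs
open import Data.Nat using (ℕ)
open import Data.Fin using (Fin)
open import Data.Fin.Subset using (Subset)
open import Data.Bool using (false)
open import Data.Rational using (ℚ; _<_)
open import Data.Product using (_×_; ∃)
open import Function.Bundles using (_⇔_)
open import Relation.Binary.PropositionalEquality using (_≡_; _≢_)

open import Data.Nat using (zero; suc)
open import Data.Fin using (zero; suc)
open import Data.Bool using (true)
open import Data.Bool.Properties using (¬-not; not-¬)
import Data.Bool as Bool
open import Data.Vec using ([]; _∷_)
open import Data.Vec.Properties using (≡-dec)
import Data.Fin.Subset as Subset
open import Data.Rational
  using (0ℚ; 1ℚ; _≤_; _+_; _*_; _-_; -_; 1/_; _⊔_; _⊓_; NonZero; positive; nonNegative)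
open import Data.Rational.Properties
open import Data.Rational.Solver using (module +-*-Solver)
open import Data.Product using (_,_; proj₁; proj₂)
open import Data.Sum using ([_,_]′)
open import Function.Base using (_∘_)
open import Function.Bundles using (mk⇔; Equivalence)
open import Level using (0ℓ)
open import Relation.Nullary using (Dec; yes; no; contradiction)
open import Relation.Unary using (Pred; Decidable)
open import Relation.Binary.PropositionalEquality using (refl; sym; trans; cong; cong₂; subst; module ≡-Reasoning)

p<q⇒0<q-p : ∀ {p q} → p < q → 0ℚ < q - p
p<q⇒0<q-p {p} {q} p<q = subst (_< q - p) (+-inverseʳ p) (+-monoˡ-< (- p) p<q)

*-monoʳ-<-pos′ : ∀ {r p q} → 0ℚ < r → p < q → r * p < r * q
*-monoʳ-<-pos′ {r} 0<r = *-monoʳ-<-pos r {{positive 0<r}}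

*-monoʳ-≤-nonNeg′ : ∀ {r p q} → 0ℚ ≤ r → p ≤ q → r * p ≤ r * q
*-monoʳ-≤-nonNeg′ {r} 0≤r = *-monoˡ-≤-nonNeg r {{nonNegative 0≤r}}

⊔-<-lub : ∀ {p q r} → p < r → q < r → p ⊔ q < r
⊔-<-lub {p} {q} p<r q<r =
  [ (λ eq → subst (_< _) (sym eq) p<r) , (λ eq → subst (_< _) (sym eq) q<r) ]′ (⊔-sel p q)

⊓-<-glb : ∀ {p q r} → r < p → r < q → r < p ⊓ q
⊓-<-glb {p} {q} r<p r<q =
  [ (λ eq → subst (_ <_) (sym eq) r<p) , (λ eq → subst (_ <_) (sym eq) r<q) ]′ (⊓-sel p q)

upper-bound-< : ∀ n {P : Pred (Subset n) 0ℓ} → Decidable P → (f : Subset n → ℚ) →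
  ∀ {c d} → d < c → (∀ S → P S → f S < c) →
  ∃ λ m → m < c × (∀ S → P S → f S ≤ m)
upper-bound-< zero P? f d<c f<c with P? []
... | yes p = f [] , f<c [] p , λ { [] _ → ≤-refl }
... | no ¬p = _ , d<c , λ { [] p → contradiction p ¬p }
upper-bound-< (suc n) P? f d<c f<c
  with upper-bound-< n (P? ∘ (true ∷_)) (f ∘ (true ∷_)) d<c (f<c ∘ (true ∷_))
     | upper-bound-< n (P? ∘ (false ∷_)) (f ∘ (false ∷_)) d<c (f<c ∘ (false ∷_))
... | m₁ , m₁<c , ≤m₁ | m₂ , m₂<c , ≤m₂ = m₁ ⊔ m₂ , ⊔-<-lub m₁<c m₂<c , λ
  { (true ∷ S) p → p≤q⇒p≤q⊔r m₂ (≤m₁ S p)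
  ; (false ∷ S) p → p≤q⇒p≤r⊔q m₁ (≤m₂ S p) }

lower-bound-< : ∀ n {P : Pred (Subset n) 0ℓ} → Decidable P → (f : Subset n → ℚ) →
  ∀ {c d} → c < d → (∀ S → P S → c < f S) →
  ∃ λ m → c < m × (∀ S → P S → m ≤ f S)
lower-bound-< zero P? f c<d c<f with P? []
... | yes p = f [] , c<f [] p , λ { [] _ → ≤-refl }
... | no ¬p = _ , c<d , λ { [] p → contradiction p ¬p }
lower-bound-< (suc n) P? f c<d c<f
  with lower-bound-< n (P? ∘ (true ∷_)) (f ∘ (true ∷_)) c<d (c<f ∘ (true ∷_))
     | lower-bound-< n (P? ∘ (false ∷_)) (f ∘ (false ∷_)) c<d (c<f ∘ (false ∷_))
... | m₁ , c<m₁ , m₁≤ | m₂ , c<m₂ , m₂≤ = m₁ ⊓ m₂ , ⊓-<-glb c<m₁ c<m₂ , λ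
  { (true ∷ S) p → p≤q⇒p⊓r≤q m₂ (m₁≤ S p)
  ; (false ∷ S) p → p≤q⇒r⊓p≤q m₁ (m₂≤ S p) }

weightOf-⊥ : ∀ n (w : Fin n → ℚ) → weightOf w (Subset.⊥ {n}) ≡ 0ℚ
weightOf-⊥ zero    w = refl
weightOf-⊥ (suc n) w = weightOf-⊥ n (w ∘ suc)

weightOf-combination : ∀ {n} (x y : ℚ) (w w′ : Fin n → ℚ) S →
  weightOf (λ i → x * w i + y * w′ i) S ≡ x * weightOf w S + y * weightOf w′ S
weightOf-combination x y w w′ [] = solve 2 (λ x y → con 0ℚ := x :* con 0ℚ :+ y :* con 0ℚ) refl x y
  where open +-*-Solver
weightOf-combination x y w w′ (false ∷ S) = weightOf-combination x y (w ∘ suc) (w′ ∘ suc) S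
weightOf-combination x y w w′ (true ∷ S) = begin
  x * w zero + y * w′ zero + weightOf (λ i → x * w (suc i) + y * w′ (suc i)) S
    ≡⟨ cong (x * w zero + y * w′ zero +_) (weightOf-combination x y (w ∘ suc) (w′ ∘ suc) S) ⟩
  x * w zero + y * w′ zero + (x * weightOf (w ∘ suc) S + y * weightOf (w′ ∘ suc) S)
    ≡⟨ solve 6 (λ x y a b c d → x :* a :+ y :* b :+ (x :* c :+ y :* d)
                               := x :* (a :+ c) :+ y :* (b :+ d))
               refl x y (w zero) (w′ zero) (weightOf (w ∘ suc) S) (weightOf (w′ ∘ suc) S) ⟩
  x * (w zero + weightOf (w ∘ suc) S) + y * (w′ zero + weightOf (w′ ∘ suc) S) ∎
  where open ≡-Reasoning
        open +-*-Solver

InSimplex-convex : ∀ {n} {x y : ℚ} {w w′ : Fin n → ℚ} → 0ℚ ≤ x → 0ℚ ≤ y → x + y ≡ 1ℚ →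
  InSimplex w → InSimplex w′ → InSimplex (λ i → x * w i + y * w′ i)
InSimplex-convex {x = x} {y} {w} {w′} 0≤x 0≤y x+y≡1 sw sw′ = record
  { nonneg = λ i → subst (_≤ x * w i + y * w′ i) 0+0≡0
      (+-mono-≤ (*-monoʳ-≤-nonNeg′ 0≤x (nonneg sw i)) (*-monoʳ-≤-nonNeg′ 0≤y (nonneg sw′ i)))
  ; mono = λ i j i≤j →
      +-mono-≤ (*-monoʳ-≤-nonNeg′ 0≤x (mono sw i j i≤j)) (*-monoʳ-≤-nonNeg′ 0≤y (mono sw′ i j i≤j))
  ; sum1 = begin
      weightOf (λ i → x * w i + y * w′ i) Subset.⊤
        ≡⟨ weightOf-combination x y w w′ Subset.⊤ ⟩
      x * weightOf w Subset.⊤ + y * weightOf w′ Subset.⊤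
        ≡⟨ cong₂ (λ a b → x * a + y * b) (sum1 sw) (sum1 sw′) ⟩
      x * 1ℚ + y * 1ℚ
        ≡⟨ cong₂ _+_ (*-identityʳ x) (*-identityʳ y) ⟩
      x + y
        ≡⟨ x+y≡1 ⟩
      1ℚ ∎ }
  where open InSimplex
        open ≡-Reasoning
        0+0≡0 : x * 0ℚ + y * 0ℚ ≡ 0ℚ
        0+0≡0 = trans (cong₂ _+_ (*-zeroʳ x) (*-zeroʳ y)) (+-identityʳ 0ℚ)

loses⇒<threshold : ∀ {n} {W : Game n} {q w} → Realizes W q w →
  ∀ C → W C ≡ false → weightOf w C < q
loses⇒<threshold R C lost = ≰⇒> (λ q≤wC → not-¬ lost (Realizes.→wins R C q≤wC))

realizes : ∀ {n} {W : Game n} {q w} → IsSimple W → InSimplex w →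
  (∀ B → Wins W B → q ≤ weightOf w B) → (∀ C → W C ≡ false → weightOf w C < q) →
  Realizes W q w
realizes {n} {W} {q} {w} sW sw q≤ <q = record
  { q-pos   = subst (_< q) (weightOf-⊥ n w) (<q Subset.⊥ (IsSimple.empty-loses sW))
  ; q-le1   = subst (q ≤_) (InSimplex.sum1 sw) (q≤ Subset.⊤ (IsSimple.full-wins sW))
  ; simplex = sw
  ; wins→   = q≤
  ; →wins   = →wins }
  where
  →wins : ∀ S → q ≤ weightOf w S → Wins W S
  →wins S q≤wS with W S Bool.≟ true
  ... | yes won = won
  ... | no ¬won = contradiction (<-≤-trans (<q S (¬-not ¬won)) q≤wS) (<-irrefl refl)

gap⇒InFootprint : ∀ {n} {W : Game n} {w} (t : ℚ) → IsSimple W → InSimplex w →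
  (∀ C → W C ≡ false → weightOf w C ≤ t) → (∀ B → Wins W B → t < weightOf w B) →
  InFootprint W w
gap⇒InFootprint {n} {W} {w} t sW sw ≤t t< =
  let t<1 = subst (t <_) (InSimplex.sum1 sw) (t< Subset.⊤ (IsSimple.full-wins sW))
      (q , t<q , q≤) = lower-bound-< n (λ B → W B Bool.≟ true) (weightOf w) t<1 t<
  in  q , realizes sW sw q≤ (λ C lost → ≤-<-trans (≤t C lost) t<q)

StrictlyBetween : ∀ {n} → Game n → Game n → Subset n → (Fin n → ℚ) → Set
StrictlyBetween v u A w =
  (∀ C → v C ≡ false → weightOf w C < weightOf w A) ×
  (∀ B → Wins u B → weightOf w A < weightOf w B)

loses-antimono : ∀ {n} {u v : Game n} → (∀ B → Wins u B → Wins v B) →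
  ∀ C → v C ≡ false → u C ≡ false
loses-antimono u⊆v C lost = ¬-not (λ won → not-¬ lost (u⊆v C won))

-- The coefficients are chosen so that the two defects p − m and q′ − p′ cancel.
defects-traded : ∀ s p m q′ p′ →
  (q′ - p′) * s * p + (p - m) * s * p′ ≡ (q′ - p′) * s * m + (p - m) * s * q′
defects-traded = solve 5 (λ s p m q′ p′ → (q′ :- p′) :* s :* p :+ (p :- m) :* s :* p′
                                        := (q′ :- p′) :* s :* m :+ (p :- m) :* s :* q′) refl
  where open +-*-Solver

realizations⇒StrictlyBetween : ∀ {n} {v u : Game n} {A : Subset n} {q q′ w w′} →
  Realizes v q w → Realizes u q′ w′ → (∀ B → Wins u B → Wins v B) →
  Wins v A → u A ≡ false →
  ∃ λ w″ → InSimplex w″ × StrictlyBetween v u A w″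
realizations⇒StrictlyBetween {n} {v} {u} {A} {q} {q′} {w} {w′} Rv Ru u⊆v vA uA
  with upper-bound-< n (λ C → v C Bool.≟ false) (weightOf w) (Realizes.q-pos Rv) (loses⇒<threshold Rv)
... | m , m<q , ≤m =
  w″ , InSimplex-convex (<⇒≤ 0<x) (<⇒≤ 0<y) x+y≡1 (Realizes.simplex Rv) (Realizes.simplex Ru) ,
  below , above
  where
  a = weightOf w A - m
  b = q′ - weightOf w′ A
  0<a : 0ℚ < a
  0<a = p<q⇒0<q-p (<-≤-trans m<q (Realizes.wins→ Rv A vA))
  0<b : 0ℚ < b
  0<b = p<q⇒0<q-p (loses⇒<threshold Ru A uA)
  D = b + a
  0<D : 0ℚ < D
  0<D = subst (_< D) (+-identityʳ 0ℚ) (+-mono-< 0<b 0<a)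
  D≢0 : NonZero D
  D≢0 = pos⇒nonZero D {{positive 0<D}}
  s : ℚ
  s = (1/ D) {{D≢0}}
  0<s : 0ℚ < s
  0<s = positive⁻¹ s {{1/pos⇒pos D {{positive 0<D}}}}
  x = b * s
  y = a * s
  0<x : 0ℚ < x
  0<x = subst (_< x) (*-zeroʳ b) (*-monoʳ-<-pos′ 0<b 0<s)
  0<y : 0ℚ < y
  0<y = subst (_< y) (*-zeroʳ a) (*-monoʳ-<-pos′ 0<a 0<s)
  x+y≡1 : x + y ≡ 1ℚ
  x+y≡1 = trans (sym (*-distribʳ-+ s b a)) (*-inverseʳ D {{D≢0}})
  w″ : Fin n → ℚ
  w″ i = x * w i + y * w′ i
  K = x * m + y * q′
  w″A≡K : weightOf w″ A ≡ K
  w″A≡K = trans (weightOf-combination x y w w′ A)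
                (defects-traded s (weightOf w A) m q′ (weightOf w′ A))
  below : ∀ C → v C ≡ false → weightOf w″ C < weightOf w″ A
  below C lost = begin-strict
    weightOf w″ C                         ≡⟨ weightOf-combination x y w w′ C ⟩
    x * weightOf w C + y * weightOf w′ C  <⟨ +-mono-≤-< (*-monoʳ-≤-nonNeg′ (<⇒≤ 0<x) (≤m C lost))
                                                 (*-monoʳ-<-pos′ 0<y (loses⇒<threshold Ru C u-lost)) ⟩
    K                                     ≡⟨ w″A≡K ⟨
    weightOf w″ A                         ∎
    where open ≤-Reasoning
          u-lost = loses-antimono u⊆v C lost
  above : ∀ B → Wins u B → weightOf w″ A < weightOf w″ B
  above B won = begin-strict
    weightOf w″ A                         ≡⟨ w″A≡K ⟩
    K                                     <⟨ +-mono-<-≤ (*-monoʳ-<-pos′ 0<x m<wB)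
                                                 (*-monoʳ-≤-nonNeg′ (<⇒≤ 0<y) (Realizes.wins→ Ru B won)) ⟩
    x * weightOf w B + y * weightOf w′ B  ≡⟨ weightOf-combination x y w w′ B ⟨
    weightOf w″ B                         ∎
    where open ≤-Reasoning
          m<wB = <-≤-trans m<q (Realizes.wins→ Rv B (u⊆v B won))

LightestWinning : ∀ {n} → Game n → Subset n → (Fin n → ℚ) → Set
LightestWinning v A w = ∀ B → Wins v B → B ≢ A → weightOf w A < weightOf w B

HeaviestLosing : ∀ {n} → Game n → Subset n → (Fin n → ℚ) → Set
HeaviestLosing u A w = ∀ C → u C ≡ false → C ≢ A → weightOf w C < weightOf w A

_≟ₛ_ : ∀ {n} → (S T : Subset n) → Dec (S ≡ T)
_≟ₛ_ = ≡-dec Bool._≟_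

module Removal {n} (v u : Game n) (A : Subset n) (vA : Wins v A)
  (removal : ∀ B → Wins u B ⇔ (Wins v B × B ≢ A)) where

  u⊆v : ∀ B → Wins u B → Wins v B
  u⊆v B = proj₁ ∘ Equivalence.to (removal B)

  u-wins⇒≢A : ∀ B → Wins u B → B ≢ A
  u-wins⇒≢A B = proj₂ ∘ Equivalence.to (removal B)

  v-wins⇒u-wins : ∀ B → Wins v B → B ≢ A → Wins u B
  v-wins⇒u-wins B won B≢A = Equivalence.from (removal B) (won , B≢A)

  A-loses-in-u : u A ≡ false
  A-loses-in-u = ¬-not (λ won → u-wins⇒≢A A won refl)

  u-loses⇒v-loses : ∀ C → u C ≡ false → C ≢ A → v C ≡ false
  u-loses⇒v-loses C lost C≢A = ¬-not (λ won → not-¬ lost (v-wins⇒u-wins C won C≢A))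

  v-loses⇒≢A : ∀ C → v C ≡ false → C ≢ A
  v-loses⇒≢A C lost refl = not-¬ lost vA

  realizes-v : ∀ {w} → IsSimple v → InSimplex w → StrictlyBetween v u A w →
    Realizes v (weightOf w A) w
  realizes-v {w} sV sw (below , above) = realizes sV sw A≤ below
    where
    A≤ : ∀ B → Wins v B → weightOf w A ≤ weightOf w B
    A≤ B won with B ≟ₛ A
    ... | yes refl = ≤-refl
    ... | no B≢A   = <⇒≤ (above B (v-wins⇒u-wins B won B≢A))

  InFootprint-u : ∀ {w} → IsSimple u → InSimplex w → StrictlyBetween v u A w →
    InFootprint u w
  InFootprint-u {w} sU sw (below , above) = gap⇒InFootprint (weightOf w A) sU sw ≤A above
    where
    ≤A : ∀ C → u C ≡ false → weightOf w C ≤ weightOf w A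
    ≤A C lost with C ≟ₛ A
    ... | yes refl = ≤-refl
    ... | no C≢A   = <⇒≤ (below C (u-loses⇒v-loses C lost C≢A))

  IsWeighted-u⇔ : IsWeighted v → IsLinear u →
    IsWeighted u ⇔ (∃ λ w → InFootprint v w × LightestWinning v A w)
  IsWeighted-u⇔ (linV , _ , _ , Rv) linU = mk⇔ to from
    where
    to : IsWeighted u → ∃ λ w → InFootprint v w × LightestWinning v A w
    to (_ , _ , _ , Ru) =
      let (w″ , sw″ , between) = realizations⇒StrictlyBetween Rv Ru u⊆v vA A-loses-in-u
      in  w″ , (_ , realizes-v (IsLinear.simple linV) sw″ between) ,
          λ B won B≢A → proj₂ between B (v-wins⇒u-wins B won B≢A)
    from : (∃ λ w → InFootprint v w × LightestWinning v A w) → IsWeighted u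
    from (w , (q , Rv) , heavier) =
      linU , w , InFootprint-u (IsLinear.simple linU) (Realizes.simplex Rv)
        ( (λ C lost → <-≤-trans (loses⇒<threshold Rv C lost) (Realizes.wins→ Rv A vA))
        , (λ B won → heavier B (u⊆v B won) (u-wins⇒≢A B won)) )

  IsWeighted-v⇔ : IsWeighted u → IsLinear v →
    IsWeighted v ⇔ (∃ λ w → InFootprint u w × HeaviestLosing u A w)
  IsWeighted-v⇔ (linU , _ , _ , Ru) linV = mk⇔ to from
    where
    to : IsWeighted v → ∃ λ w → InFootprint u w × HeaviestLosing u A w
    to (_ , _ , _ , Rv) =
      let (w″ , sw″ , between) = realizations⇒StrictlyBetween Rv Ru u⊆v vA A-loses-in-u
      in  w″ , InFootprint-u (IsLinear.simple linU) sw″ between ,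
          λ C lost C≢A → proj₁ between C (u-loses⇒v-loses C lost C≢A)
    from : (∃ λ w → InFootprint u w × HeaviestLosing u A w) → IsWeighted v
    from (w , (q′ , Ru) , lighter) =
      linV , w , _ , realizes-v (IsLinear.simple linV) (Realizes.simplex Ru)
        ( (λ C lost → lighter C (loses-antimono u⊆v C lost) (v-loses⇒≢A C lost))
        , (λ B won → <-≤-trans (loses⇒<threshold Ru A A-loses-in-u) (Realizes.wins→ Ru B won)) )

theorem4p17 :
  ((n : ℕ) (v u : Game n) (A : Subset n) →
    IsWeighted v → IsLinear u → Wins v A →
    (∀ B → Wins u B ⇔ (Wins v B × B ≢ A)) →
    (IsWeighted u ⇔
      (∃ λ (w : Fin n → ℚ) → InFootprint v w ×
        (∀ B → Wins v B → B ≢ A → weightOf w A < weightOf w B))))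
  ×
  ((n : ℕ) (u v : Game n) (A : Subset n) →
    IsWeighted u → IsLinear v → Wins v A →
    (∀ B → Wins u B ⇔ (Wins v B × B ≢ A)) →
    (IsWeighted v ⇔
      (∃ λ (w : Fin n → ℚ) → InFootprint u w ×
        (∀ C → u C ≡ false → C ≢ A → weightOf w C < weightOf w A))))
theorem4p17 =
  (λ n v u A weighted-v linear-u vA removal →
     Removal.IsWeighted-u⇔ v u A vA removal weighted-v linear-u) ,
  (λ n u v A weighted-u linear-v vA removal →
     Removal.IsWeighted-v⇔ v u A vA removal weighted-u linear-v)
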